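{- Every graph $G$ admits an isoarithmetic integer additive set-indexer.
   Context: All graphs are simple and finite with no isolated vertices. Let $\mathbb{N}_0$ be the set of non-negative integers and $\mathcal{P}(\mathbb{N}_0)$ its power set; all sets used as labels are finite and non-empty. For sets $A,B$, the sum set is $A+B=\{a+b: a\in A, b\in B\}$. An integer additive set-indexer (IASI) of $G$ is an injective map $f:V(G)\to\mathcal{P}(\mathbb{N}_0)$ such that the induced map $f^+:E(G)\to\mathcal{P}(\mathbb{N}_0)$, $f^+(uv)=f(u)+f(v)$, is also injective. An AP-set is a finite set of integers with at least three elements whose elements form an arithmetic progression; its common difference is called the deterministic index of the element (vertex or edge) it labels. An IASI $f$ is arithmetic if $f(v)$ is an AP-set for every vertex $v$ and $f^+(e)$ is an AP-set for every edge $e$. An arithmetic IASI is isoarithmetic if all vertices and edges of $G$ have the same deterministic index. -}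

module Defs where

open import Level using (Level; _⊔_) renaming (suc to lsuc; zero to lzero)
open import Data.Nat using (ℕ; suc; _+_; _*_; _≤_)
open import Data.Fin using (Fin)
open import Data.List using (List; map; upTo; cartesianProductWith)
open import Data.List.Membership.Propositional using (_∈_)
open import Data.Product using (Σ; _×_; ∃; ∃-syntax)
open import Data.Sum using (_⊎_)
open import Relation.Binary.PropositionalEquality using (_≡_)
open import Relation.Nullary using (¬_)

record Graph : Set₁ where
  field
    n          : ℕ
    Adj        : Fin n → Fin n → Set
    sym        : ∀ {u v} → Adj u v → Adj v u
    irrefl     : ∀ {u} → ¬ Adj u u
    noIsolated : ∀ u → ∃[ v ] Adj u v

-- Finite sets of non-negative integers, represented by lists (up to set equality).
FinSet : Set
FinSet = List ℕ

_≋_ : FinSet → FinSet → Set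
A ≋ B = ∀ x → (x ∈ A → x ∈ B) × (x ∈ B → x ∈ A)

_⊕_ : FinSet → FinSet → FinSet
A ⊕ B = cartesianProductWith _+_ A B

-- S is an AP-set (at least three elements) with common difference d:
-- S = { a, a + d, ..., a + k d } with k ≥ 2 and d ≥ 1.
IsAPSetWithDiff : ℕ → FinSet → Set
IsAPSetWithDiff d S =
  ∃[ a ] ∃[ k ] (2 ≤ k × 1 ≤ d × S ≋ map (λ i → a + i * d) (upTo (suc k)))

record IsIASI (G : Graph) (f : Fin (Graph.n G) → FinSet) : Set where
  open Graph G
  field
    vertexInjective : ∀ u v → f u ≋ f v → u ≡ v
    edgeInjective   : ∀ u v x y → Adj u v → Adj x y →
                      (f u ⊕ f v) ≋ (f x ⊕ f y) →
                      (u ≡ x × v ≡ y) ⊎ (u ≡ y × v ≡ x)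

IsIsoarithmeticIASI : (G : Graph) → (Fin (Graph.n G) → FinSet) → Set
IsIsoarithmeticIASI G f =
  IsIASI G f ×
  ∃[ d ] ((∀ v → IsAPSetWithDiff d (f v)) ×
          (∀ u v → Graph.Adj G u v → IsAPSetWithDiff d (f u ⊕ f v)))

-- Label vertex i by the integer interval [i, i + 2 + i²], an AP-set of common difference 1.
-- Sums of intervals are intervals, [a, a + k] + [b, b + l] = [a + b, a + b + k + l], and an
-- interval determines its endpoints; so the label of an edge uv determines u + v and
-- u² + v², which together determine the unordered pair {u, v}.
module Submission where

open import Defs
open import Data.Fin using (Fin; toℕ)
open import Data.Fin.Properties using (toℕ-injective)
open import Data.Product using (∃-syntax; _,_; _×_; proj₁; proj₂)
open import Data.Sum using (_⊎_; inj₁; inj₂; map)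
open import Data.Nat using (ℕ; zero; suc; _+_; _*_; _≤_; z≤n; s≤s)
open import Data.Nat.Properties
open import Data.Nat.Tactic.RingSolver using (solve-∀)
open import Data.List using (upTo) renaming (map to mapList)
open import Data.List.Membership.Propositional using (_∈_)
open import Data.List.Membership.Propositional.Properties
  using (∈-map⁺; ∈-map⁻; ∈-upTo⁺; ∈-upTo⁻; ∈-cartesianProductWith⁺; ∈-cartesianProductWith⁻)
open import Relation.Binary.PropositionalEquality
open ≡-Reasoning

≋-refl : ∀ {A} → A ≋ A
≋-refl x = (λ p → p) , (λ p → p)

≋-sym : ∀ {A B} → A ≋ B → B ≋ A
≋-sym A≋B x = proj₂ (A≋B x) , proj₁ (A≋B x)

≋-trans : ∀ {A B C} → A ≋ B → B ≋ C → A ≋ C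
≋-trans A≋B B≋C x = (λ p → proj₁ (B≋C x) (proj₁ (A≋B x) p))
                  , (λ p → proj₂ (A≋B x) (proj₂ (B≋C x) p))

apSet : ℕ → ℕ → ℕ → FinSet
apSet a d k = mapList (λ i → a + i * d) (upTo (suc k))

interval : ℕ → ℕ → FinSet
interval a k = apSet a 1 k

∈-interval⁺ : ∀ {a k t} → t ≤ k → a + t ∈ interval a k
∈-interval⁺ {a} {k} {t} t≤k = subst (_∈ interval a k) (cong (a +_) (*-identityʳ t))
  (∈-map⁺ (λ i → a + i * 1) (∈-upTo⁺ (s≤s t≤k)))

∈-interval⁻ : ∀ {a k x} → x ∈ interval a k → ∃[ t ] (t ≤ k × x ≡ a + t)
∈-interval⁻ {a} {k} x∈ with ∈-map⁻ (λ i → a + i * 1) {xs = upTo (suc k)} x∈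
... | i , i∈ , refl = i , ≤-pred (∈-upTo⁻ i∈) , cong (a +_) (*-identityʳ i)

split-≤-+ : ∀ {t} k l → t ≤ k + l → ∃[ i ] ∃[ j ] (i ≤ k × j ≤ l × t ≡ i + j)
split-≤-+ {t}     zero    l t≤l           = 0 , t , z≤n , t≤l , refl
split-≤-+ {zero}  (suc k) l _             = 0 , 0 , z≤n , z≤n , refl
split-≤-+ {suc t} (suc k) l (s≤s t≤k+l) with split-≤-+ k l t≤k+l
... | i , j , i≤k , j≤l , refl = suc i , j , s≤s i≤k , j≤l , refl

interval-⊕ : ∀ a k b l → (interval a k ⊕ interval b l) ≋ interval (a + b) (k + l)
interval-⊕ a k b l x = to , from
  where
  shuffle : ∀ a b i j → (a + i) + (b + j) ≡ (a + b) + (i + j)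
  shuffle = solve-∀

  to : x ∈ interval a k ⊕ interval b l → x ∈ interval (a + b) (k + l)
  to x∈ with ∈-cartesianProductWith⁻ _+_ (interval a k) (interval b l) x∈
  ... | _ , _ , p∈ , q∈ , refl with ∈-interval⁻ p∈ | ∈-interval⁻ q∈
  ... | i , i≤k , refl | j , j≤l , refl =
    subst (_∈ interval (a + b) (k + l)) (sym (shuffle a b i j)) (∈-interval⁺ (+-mono-≤ i≤k j≤l))

  from : x ∈ interval (a + b) (k + l) → x ∈ interval a k ⊕ interval b l
  from x∈ with ∈-interval⁻ x∈
  ... | t , t≤k+l , refl with split-≤-+ k l t≤k+l
  ... | i , j , i≤k , j≤l , refl =
    subst (_∈ interval a k ⊕ interval b l) (shuffle a b i j)
      (∈-cartesianProductWith⁺ _+_ (∈-interval⁺ i≤k) (∈-interval⁺ j≤l))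

interval-start-≤ : ∀ {a k c m} → interval a k ≋ interval c m → c ≤ a
interval-start-≤ {a} {k} {c} eq with ∈-interval⁻ (proj₁ (eq (a + 0)) (∈-interval⁺ z≤n))
... | t , _ , a+0≡c+t = ≤-trans (m≤m+n c t) (≤-reflexive (trans (sym a+0≡c+t) (+-identityʳ a)))

interval-end-≤ : ∀ {a k c m} → interval a k ≋ interval c m → a + k ≤ c + m
interval-end-≤ {a} {k} {c} eq with ∈-interval⁻ (proj₁ (eq (a + k)) (∈-interval⁺ ≤-refl))
... | t , t≤m , a+k≡c+t = ≤-trans (≤-reflexive a+k≡c+t) (+-monoʳ-≤ c t≤m)

interval-injective : ∀ {a k c m} → interval a k ≋ interval c m → a ≡ c × k ≡ m
interval-injective {a} {k} {c} {m} eq = a≡c , +-cancelˡ-≡ a k m a+k≡a+m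
  where
  a≡c : a ≡ c
  a≡c = ≤-antisym (interval-start-≤ (≋-sym eq)) (interval-start-≤ eq)
  a+k≡a+m : a + k ≡ a + m
  a+k≡a+m = trans (≤-antisym (interval-end-≤ eq) (interval-end-≤ (≋-sym eq)))
                  (cong (_+ m) (sym a≡c))

Swapped : ∀ {A : Set} → A → A → A → A → Set
Swapped u v x y = (u ≡ x × v ≡ y) ⊎ (u ≡ y × v ≡ x)

-- Expanding the squares leaves 2ty = 2tu.
sum-sq-cross : ∀ u t y → u * u + (t + y) * (t + y) ≡ (u + t) * (u + t) + y * y → t * y ≡ t * u
sum-sq-cross u t y eq = *-cancelˡ-≡ (t * y) (t * u) 2 (+-cancelˡ-≡ (u * u + t * t + y * y) _ _ (begin
  u * u + t * t + y * y + 2 * (t * y)  ≡⟨ lhs u t y ⟩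
  u * u + (t + y) * (t + y)            ≡⟨ eq ⟩
  (u + t) * (u + t) + y * y            ≡⟨ rhs u t y ⟩
  u * u + t * t + y * y + 2 * (t * u)  ∎))
  where
  lhs : ∀ u t y → u * u + t * t + y * y + 2 * (t * y) ≡ u * u + (t + y) * (t + y)
  lhs = solve-∀
  rhs : ∀ u t y → (u + t) * (u + t) + y * y ≡ u * u + t * t + y * y + 2 * (t * u)
  rhs = solve-∀

sum-sq-injective-≤ : ∀ {u v x y} → u ≤ x → u + v ≡ x + y →
                     u * u + v * v ≡ x * x + y * y → Swapped u v x y
sum-sq-injective-≤ {u} {v} {x} {y} u≤x sum≡ sq≡ with m≤n⇒∃[o]m+o≡n u≤x
... | t , refl with +-cancelˡ-≡ u v (t + y) (trans sum≡ (+-assoc u t y))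
... | refl with t | sum-sq-cross u t y sq≡
...   | zero  | _      = inj₁ (sym (+-identityʳ u) , refl)
...   | suc s | sy≡su  with *-cancelˡ-≡ y u (suc s) sy≡su
...     | refl = inj₂ (refl , +-comm (suc s) y)

sum-sq-injective : ∀ {u v x y} → u + v ≡ x + y →
                   u * u + v * v ≡ x * x + y * y → Swapped u v x y
sum-sq-injective {u} {v} {x} {y} sum≡ sq≡ with ≤-total u x
... | inj₁ u≤x = sum-sq-injective-≤ u≤x sum≡ sq≡
... | inj₂ x≤u = flip (sum-sq-injective-≤ x≤u (sym sum≡) (sym sq≡))
  where
  flip : Swapped x y u v → Swapped u v x y
  flip (inj₁ (x≡u , y≡v)) = inj₁ (sym x≡u , sym y≡v)
  flip (inj₂ (x≡v , y≡u)) = inj₂ (sym y≡u , sym x≡v)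

width : ℕ → ℕ
width i = 2 + i * i

label : ℕ → FinSet
label i = interval i (width i)

label-⊕-injective : ∀ {u v x y} → (label u ⊕ label v) ≋ (label x ⊕ label y) → Swapped u v x y
label-⊕-injective {u} {v} {x} {y} eq with interval-injective
  (≋-trans (≋-sym (interval-⊕ u (width u) v (width v))) (≋-trans eq (interval-⊕ x (width x) y (width y))))
... | sum≡ , widths≡ = sum-sq-injective sum≡ (+-cancelˡ-≡ 4 _ _ (begin
  4 + (u * u + v * v)      ≡⟨ widths u v ⟩
  width u + width v        ≡⟨ widths≡ ⟩
  width x + width y        ≡⟨ widths x y ⟨
  4 + (x * x + y * y)      ∎))
  where
  widths : ∀ a b → 4 + (a * a + b * b) ≡ (2 + a * a) + (2 + b * b)
  widths = solve-∀

theorem2p3 : (G : Graph) → ∃[ f ] IsIsoarithmeticIASI G f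
theorem2p3 G = f , iasi , 1 , vertexAP , edgeAP
  where
  f : Fin (Graph.n G) → FinSet
  f v = label (toℕ v)

  iasi : IsIASI G f
  IsIASI.vertexInjective iasi u v eq = toℕ-injective (proj₁ (interval-injective eq))
  IsIASI.edgeInjective iasi u v x y _ _ eq =
    map (λ (p , q) → toℕ-injective p , toℕ-injective q)
        (λ (p , q) → toℕ-injective p , toℕ-injective q)
        (label-⊕-injective eq)

  vertexAP : ∀ v → IsAPSetWithDiff 1 (f v)
  vertexAP v = toℕ v , width (toℕ v) , m≤m+n 2 _ , ≤-refl , ≋-refl

  edgeAP : ∀ u v → Graph.Adj G u v → IsAPSetWithDiff 1 (f u ⊕ f v)
  edgeAP u v _ = toℕ u + toℕ v , width (toℕ u) + width (toℕ v)
               , ≤-trans (m≤m+n 2 _) (m≤m+n (width (toℕ u)) _) , ≤-refl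
               , interval-⊕ (toℕ u) (width (toℕ u)) (toℕ v) (width (toℕ v))
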